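{- Let $N\ge5$ be odd, and let $A$ be an efficiently structured polyomino whose interior is an $(N-2)\times(N-2)$ square; index the cells of the $N\times N$ square containing $A$ by $(r,c)$, $1\le r,c\le N$, row 1 at the top, so that the interior is $\{(r,c): 2\le r,c\le N-1\}$. Then every interior cell $(r,c)$ with $r$ even and $c$ even is empty (lies in a hole of $A$).
   Context: A polyomino is a finite union of closed unit squares (tiles) of the square lattice, any two of which intersect in nothing, a vertex, or an entire common edge, with connected interior; holes are bounded components of the complement; area of a hole = number of lattice cells in it; acyclic means the dual graph (tiles, adjacency across edges) is a tree; the outer perimeter $p_o$ is the number of boundary unit edges not bounding a hole. A polyomino with $n$ tiles and $h$ holes is efficiently structured if it is acyclic, all holes have area one, and $p_o=2\lceil2\sqrt{n+h}\,\rceil$. The boundary layer is the set of tiles with an edge on the outer perimeter; the interior is the set of lattice cells enclosed by the outer perimeter not in the boundary layer. (In the paper's terms: the cells in the odd rows, counted from the top of the interior, of the checkerboard class $W$ containing the top-left interior cell.) -}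

module Defs where

open import Data.Nat as ℕ using (ℕ; _<_)
open import Data.Integer as ℤ using (ℤ; +_; ∣_∣)
open import Data.Product using (Σ; ∃; ∃-syntax; _×_; _,_; proj₁; proj₂)
open import Data.Sum using (_⊎_)
open import Data.List using (List; length)
open import Data.List.Membership.Propositional using (_∈_; _∉_)
open import Data.List.Relation.Unary.All using (All)
open import Data.List.Relation.Unary.Any using (Any)
open import Data.List.Relation.Unary.AllPairs using (AllPairs)
open import Data.List.Relation.Unary.Linked using (Linked)
open import Data.List.Relation.Unary.Unique.Propositional using (Unique)
open import Relation.Binary.PropositionalEquality using (_≡_)
open import Relation.Nullary using (¬_)
open import Function.Bundles using (_⇔_)

-- A lattice cell (closed unit square) of ℤ², indexed by (row , column).
Cell : Set
Cell = ℤ × ℤ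

Adj : Cell → Cell → Set
Adj (r , c) (r' , c') =
  ((r' ≡ r ℤ.+ ℤ.1ℤ ⊎ r ≡ r' ℤ.+ ℤ.1ℤ) × c ≡ c')
  ⊎ (r ≡ r' × (c' ≡ c ℤ.+ ℤ.1ℤ ⊎ c ≡ c' ℤ.+ ℤ.1ℤ))

-- A finite set of tiles, given as a duplicate-free list of cells.
Tiles : Set
Tiles = List Cell

data Path (P : Cell → Set) : Cell → Cell → Set where
  stop : ∀ {x} → P x → Path P x x
  step : ∀ {x y z} → P x → Adj x y → Path P y z → Path P x z

Tile : Tiles → Cell → Set
Tile A x = x ∈ A

Empty : Tiles → Cell → Set
Empty A x = x ∉ A

-- Polyomino: distinct tiles, connected interior (= edge-connected tile set).
IsPolyomino : Tiles → Set
IsPolyomino A = Unique A × (∀ x y → x ∈ A → y ∈ A → Path (Tile A) x y)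

Cycle : Tiles → Set
Cycle A = Σ (List Cell) λ vs → Σ Cell λ v0 → Σ Cell λ vl →
  (2 < length vs) × Unique vs × All (Tile A) vs × Linked Adj vs ×
  (Data.List.head vs ≡ Data.Maybe.just v0) × (Data.List.last vs ≡ Data.Maybe.just vl) ×
  Adj vl v0
  where import Data.List ; import Data.Maybe

-- Dual graph is a tree: connected (part of IsPolyomino) and has no cycle.
Acyclic : Tiles → Set
Acyclic A = (∀ x y → x ∈ A → y ∈ A → Path (Tile A) x y) × ¬ Cycle A

-- x lies in the unbounded component of the complement: x is empty and
-- reaches arbitrarily far cells through empty cells.
Outside : Tiles → Cell → Set
Outside A x = Empty A x × (∀ (B : ℕ) → ∃[ y ] (Path (Empty A) x y × (B < ∣ proj₁ y ∣ ⊎ B < ∣ proj₂ y ∣)))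

-- x lies in a hole (a bounded component of the complement).
HoleCell : Tiles → Cell → Set
HoleCell A x = Empty A x × ¬ Outside A x

-- Hs is a list of representatives, exactly one per hole; h = length Hs.
IsHoleReps : Tiles → List Cell → Set
IsHoleReps A Hs =
  All (HoleCell A) Hs ×
  AllPairs (λ x y → ¬ Path (Empty A) x y) Hs ×
  (∀ x → HoleCell A x → Any (λ y → Path (Empty A) x y) Hs)

HolesAreaOne : Tiles → Set
HolesAreaOne A = ∀ x y → HoleCell A x → Path (Empty A) x y → x ≡ y

-- Es is the list of outer-perimeter unit edges, each edge represented by
-- the pair (tile , neighbouring cell in the unbounded component); p_o = length Es.
IsOuterPerimeter : Tiles → List (Cell × Cell) → Set
IsOuterPerimeter A Es =
  Unique Es × (∀ t e → ((t , e) ∈ Es) ⇔ (t ∈ A × Adj t e × Outside A e))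

-- k = ⌈ 2 √ m ⌉  (least natural k with 4m ≤ k²).
IsCeilTwoSqrt : ℕ → ℕ → Set
IsCeilTwoSqrt m k = (4 ℕ.* m ℕ.≤ k ℕ.* k) × (∀ j → 4 ℕ.* m ℕ.≤ j ℕ.* j → k ℕ.≤ j)

EfficientlyStructured : Tiles → Set
EfficientlyStructured A =
  Acyclic A × HolesAreaOne A ×
  Σ (List Cell) λ Hs → IsHoleReps A Hs ×
  Σ (List (Cell × Cell)) λ Es → IsOuterPerimeter A Es ×
  Σ ℕ λ k → IsCeilTwoSqrt (length A ℕ.+ length Hs) k × length Es ≡ 2 ℕ.* k

BoundaryLayer : Tiles → Cell → Set
BoundaryLayer A x = x ∈ A × ∃[ e ] (Adj x e × Outside A e)

Interior : Tiles → Cell → Set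
Interior A x = ¬ Outside A x × ¬ BoundaryLayer A x

InSquare : ℕ → ℕ → Cell → Set
InSquare lo hi (r , c) = (+ lo ℤ.≤ r × r ℤ.≤ + hi) × (+ lo ℤ.≤ c × c ℤ.≤ + hi)

module Submission where

-- Embed the polyomino in the grid ℕ × ℕ and call a cell mixed
-- when exactly one of its coordinates is odd.  The theorem's hypotheses give:
-- the non-corner cells of the frame (rows/columns 1 and N) are tiles, no two
-- adjacent cells are empty when one of them is interior (holes have area one),
-- and the dual graph has no cycle.
--   (1) Every mixed cell of the square [1,N]² is a tile.  Otherwise consider
--       the 2×2 blocks containing an empty mixed interior cell: the cells on
--       the boundary ("walls") between such blocks and the remaining ones are
--       tiles and, since every cell meets an even number of walls, a walk
--       along the walls never gets stuck and so closes a cycle of tiles.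
--   (2) Along any tile path starting at an even-even tile, every tile is
--       even-even or is mixed and adjacent to an even-even tile: stepping to
--       an odd-odd tile would close a 2×2 square of tiles by (1).  The frame
--       tile (1,3) is odd-odd, and it is connected to every tile, so no
--       even-even cell is a tile; interior empty cells are holes.

open import Defs
open import Data.Nat using (ℕ; _≤_; _∸_)
open import Data.Nat.Divisibility using (_∣_)
open import Data.Integer using (+_)
open import Data.Product using (_×_; _,_)
open import Data.List.Membership.Propositional using (_∈_)
open import Relation.Nullary using (¬_)
open import Function.Bundles using (_⇔_)

open import Data.Nat using (zero; suc; _+_; _*_; _<_; z≤n; s≤s; >-nonZero)
open import Data.Nat.Properties as ℕ
  using (+-suc; +-comm; +-identityʳ; ≤-trans; ≤-refl; n≤1+n; <⇒≱; <⇒≤pred; ≤∧≢⇒<; 1+n≰n)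
open import Data.Nat.Divisibility using (divides)
open import Data.Integer as ℤ using (ℤ)
open import Data.Integer.Properties using (+-injective; drop‿+≤+)
open import Data.Bool as Bool using (Bool; true; false; not)
open import Data.Bool.Properties using (¬-not; not-injective; not-involutive)
open import Data.Product using (Σ; ∃; ∃-syntax; proj₁; proj₂)
open import Data.Product.Properties using (≡-dec)
open import Data.Sum using (_⊎_; inj₁; inj₂)
open import Data.Empty using (⊥; ⊥-elim)
open import Data.List using (List; []; _∷_; length; map; head; last; _++_)
open import Data.List.Properties using (length-map; length-++; head-map; last-map)
open import Data.Maybe using (just)
import Data.Maybe as Maybe
open import Data.List.Membership.Propositional.Properties using (∈-∃++; ∈-++⁻; ∈-++⁺ˡ; ∈-++⁺ʳ)
open import Data.List.Relation.Unary.Any using (here; there)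
open import Data.List.Relation.Unary.All as All using (All; []; _∷_)
import Data.List.Relation.Unary.All.Properties as All
open import Data.List.Relation.Unary.AllPairs using ([]; _∷_)
open import Data.List.Relation.Unary.Linked as Linked using (Linked; [-]; _∷_)
import Data.List.Relation.Unary.Linked.Properties as Linked
open import Data.List.Relation.Unary.Unique.Propositional using (Unique)
import Data.List.Relation.Unary.Unique.Propositional.Properties as Unique
open import Relation.Binary.Definitions using (DecidableEquality)
open import Relation.Binary.PropositionalEquality
  using (_≡_; _≢_; refl; sym; trans; subst; cong; ≢-sym)
open import Relation.Nullary using (Dec; yes; no; does; _×-dec_; _⊎-dec_; ¬?)
open import Relation.Nullary.Decidable using (decidable-stable; dec-true; dec-false; does-⇔)
open import Function using (_∘_)
open import Function.Bundles using (Equivalence; mk⇔)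

CycleIn : {X : Set} → (X → X → Set) → (X → Set) → Set
CycleIn {X} R P = Σ (List X) λ vs → Σ X λ v0 → Σ X λ vl →
  (2 < length vs) × Unique vs × All P vs × Linked R vs ×
  (head vs ≡ just v0) × (last vs ≡ just vl) × R vl v0

mapCycle : {X Y : Set} {R : X → X → Set} {P : X → Set} {R' : Y → Y → Set} {P' : Y → Set}
  (f : X → Y) → (∀ {x y} → f x ≡ f y → x ≡ y) →
  (∀ {x y} → R x y → R' (f x) (f y)) → (∀ {x} → P x → P' (f x)) →
  CycleIn R P → CycleIn R' P'
mapCycle f injective edge vertex (vs , v0 , vl , long , distinct , onP , linked , first , final , closing) =
  map f vs , f v0 , f vl ,
  subst (2 <_) (sym (length-map f vs)) long ,
  Unique.map⁺ injective distinct ,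
  All.map⁺ (All.map vertex onP) ,
  Linked.map⁺ (Linked.map edge linked) ,
  trans (head-map {f = f} vs) (cong (Maybe.map f) first) ,
  trans (last-map f vs) (cong (Maybe.map f) final) ,
  edge closing

unique-⊆-length : {X : Set} (xs ys : List X) → Unique xs → (∀ {x} → x ∈ xs → x ∈ ys) →
  length xs ≤ length ys
unique-⊆-length []       ys _                  _   = z≤n
unique-⊆-length (x ∷ xs) ys (x∉xs ∷ distinct) xs⊆ys with ∈-∃++ (xs⊆ys (here refl))
... | us , vs , refl =
  subst (suc (length xs) ≤_) (sym length-split)
    (s≤s (unique-⊆-length xs (us ++ vs) distinct xs⊆rest))
  where
  length-split : length (us ++ x ∷ vs) ≡ suc (length (us ++ vs))
  length-split = trans (length-++ us) (trans (+-suc (length us) (length vs))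
                   (cong suc (sym (length-++ us))))
  xs⊆rest : ∀ {y} → y ∈ xs → y ∈ us ++ vs
  xs⊆rest y∈xs with ∈-++⁻ us (xs⊆ys (there y∈xs))
  ... | inj₁ y∈us         = ∈-++⁺ˡ y∈us
  ... | inj₂ (here refl)  = ⊥-elim (All.lookup x∉xs y∈xs refl)
  ... | inj₂ (there y∈vs) = ∈-++⁺ʳ us y∈vs

-- A graph on a bounded set of P-vertices in which every edge x—y can be
-- continued by an edge y—z with z ≠ x contains a cycle: walking without
-- backtracking must revisit a vertex.
module WalkWithoutDeadEnds {X : Set} (_≟_ : DecidableEquality X)
  {R : X → X → Set} {P : X → Set}
  (irreflexive : ∀ {x} → ¬ R x x) (symmetric : ∀ {x y} → R x y → R y x)
  (source : ∀ {x y} → R x y → P x)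
  (continues : ∀ {x y} → R x y → ∃[ z ] (R y z × z ≢ x))
  (B : ℕ) (bounded : ∀ xs → Unique xs → All P xs → length xs ≤ B) where

  open import Data.List.Membership.DecPropositional _≟_ using (_∈?_)

  prefixTo : X → List X → List X
  prefixTo z []       = []
  prefixTo z (w ∷ ws) with z ≟ w
  ... | yes _ = w ∷ []
  ... | no  _ = w ∷ prefixTo z ws

  prefixTo-last : ∀ z a ws → z ∈ ws → last (a ∷ prefixTo z ws) ≡ just z
  prefixTo-last z a (w ∷ ws) z∈ with z ≟ w
  prefixTo-last z a (w ∷ ws) z∈          | yes refl = refl
  prefixTo-last z a (w ∷ ws) (here refl) | no z≢w   = ⊥-elim (z≢w refl)
  prefixTo-last z a (w ∷ ws) (there z∈)  | no _     = prefixTo-last z w ws z∈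

  prefixTo-nonempty : ∀ z ws → z ∈ ws → 1 ≤ length (prefixTo z ws)
  prefixTo-nonempty z (w ∷ ws) _ with z ≟ w
  ... | yes _ = s≤s z≤n
  ... | no  _ = s≤s z≤n

  prefixTo-all : ∀ {Q : X → Set} z ws → All Q ws → All Q (prefixTo z ws)
  prefixTo-all z []       []       = []
  prefixTo-all z (w ∷ ws) (q ∷ qs) with z ≟ w
  ... | yes _ = q ∷ []
  ... | no  _ = q ∷ prefixTo-all z ws qs

  prefixTo-unique : ∀ z ws → Unique ws → Unique (prefixTo z ws)
  prefixTo-unique z []       []                = []
  prefixTo-unique z (w ∷ ws) (w∉ws ∷ distinct) with z ≟ w
  ... | yes _ = [] ∷ []
  ... | no  _ = prefixTo-all z ws w∉ws ∷ prefixTo-unique z ws distinct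

  prefixTo-linked : ∀ z a ws → Linked R (a ∷ ws) → Linked R (a ∷ prefixTo z ws)
  prefixTo-linked z a []       _              = [-]
  prefixTo-linked z a (w ∷ ws) (raw ∷ linked) with z ≟ w
  ... | yes _ = raw ∷ [-]
  ... | no  _ = raw ∷ prefixTo-linked z w ws linked

  -- A trail y ∷ x ∷ rest (latest vertex first) of distinct P-vertices; fuel
  -- bounds how many more vertices can be added before exceeding B.
  walk : (fuel : ℕ) (y x : X) (rest : List X) →
         Linked R (y ∷ x ∷ rest) → Unique (y ∷ x ∷ rest) → All P (y ∷ x ∷ rest) →
         B < length (y ∷ x ∷ rest) + fuel → CycleIn R P
  -- Step on from y to some z ≠ x: if z occurs in rest, the trail up to z
  -- closes a cycle (z = y is impossible); otherwise z extends the trail,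
  -- which the bound B permits only while fuel remains.
  walk fuel y x rest (ryx ∷ linked) ((y∉ ∷ y∉rest) ∷ x∉rest ∷ distinct) (py ∷ px ∷ onP) room
    with continues (symmetric ryx)
  ... | z , ryz , z≢x with z ∈? rest | z ≟ y
  ... | yes z∈rest | _ =
    (y ∷ x ∷ prefixTo z rest) , y , z ,
    s≤s (s≤s (prefixTo-nonempty z rest z∈rest)) ,
    ((y∉ ∷ prefixTo-all z rest y∉rest) ∷ prefixTo-all z rest x∉rest ∷ prefixTo-unique z rest distinct) ,
    (py ∷ px ∷ prefixTo-all z rest onP) ,
    (ryx ∷ prefixTo-linked z x rest linked) ,
    refl , prefixTo-last z x rest z∈rest , symmetric ryz
  ... | no _ | yes refl = ⊥-elim (irreflexive ryz)
  ... | no z∉rest | no z≢y = extend fuel room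
    where
    trail : List X
    trail = y ∷ x ∷ rest
    extend : (fuel : ℕ) → B < length trail + fuel → CycleIn R P
    extend zero    room' =
      ⊥-elim (<⇒≱ (subst (B <_) (+-identityʳ _) room')
                  (bounded trail ((y∉ ∷ y∉rest) ∷ x∉rest ∷ distinct) (py ∷ px ∷ onP)))
    extend (suc fuel') room' =
      walk fuel' z y (x ∷ rest) (symmetric ryz ∷ ryx ∷ linked)
        ((z≢y ∷ z≢x ∷ All.¬Any⇒All¬ rest z∉rest) ∷ (y∉ ∷ y∉rest) ∷ x∉rest ∷ distinct)
        (source (symmetric ryz) ∷ py ∷ px ∷ onP)
        (subst (B <_) (+-suc (length trail) fuel') room')

  cycleThrough : ∀ {x y} → R x y → CycleIn R P
  cycleThrough {x} {y} rxy =
    walk B y x [] (symmetric rxy ∷ [-]) ((y≢x ∷ []) ∷ [] ∷ [])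
      (source (symmetric rxy) ∷ source rxy ∷ []) (s≤s (n≤1+n B))
    where
    y≢x : y ≢ x
    y≢x refl = irreflexive rxy

Pt : Set
Pt = ℕ × ℕ

OneApart : ℕ → ℕ → Set
OneApart a b = b ≡ suc a ⊎ a ≡ suc b

apart-sym : ∀ {a b} → OneApart a b → OneApart b a
apart-sym (inj₁ e) = inj₂ e
apart-sym (inj₂ e) = inj₁ e

apart-irrefl : ∀ {a} → ¬ OneApart a a
apart-irrefl (inj₁ ())
apart-irrefl (inj₂ ())

GridAdj : Pt → Pt → Set
GridAdj (i , j) (i' , j') = (OneApart i i' × j ≡ j') ⊎ (i ≡ i' × OneApart j j')

Diagonal : Pt → Pt → Set
Diagonal (i , j) (i' , j') = OneApart i i' × OneApart j j'

grid-adj-sym : ∀ {x y} → GridAdj x y → GridAdj y x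
grid-adj-sym (inj₁ (d , refl)) = inj₁ (apart-sym d , refl)
grid-adj-sym (inj₂ (refl , d)) = inj₂ (refl , apart-sym d)

grid-adj-irrefl : ∀ {x} → ¬ GridAdj x x
grid-adj-irrefl (inj₁ (d , _)) = apart-irrefl d
grid-adj-irrefl (inj₂ (_ , d)) = apart-irrefl d

near-points : ∀ {i j i' j'} → (i ≡ i' ⊎ OneApart i i') → (j ≡ j' ⊎ OneApart j j') →
  (i , j) ≡ (i' , j') ⊎ GridAdj (i , j) (i' , j') ⊎ Diagonal (i , j) (i' , j')
near-points (inj₁ refl) (inj₁ refl) = inj₁ refl
near-points (inj₁ refl) (inj₂ d)    = inj₂ (inj₁ (inj₂ (refl , d)))
near-points (inj₂ d)    (inj₁ refl) = inj₂ (inj₁ (inj₁ (d , refl)))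
near-points (inj₂ d)    (inj₂ d')   = inj₂ (inj₂ (d , d'))

data GridPath (Q : Pt → Set) : Pt → Pt → Set where
  stop : ∀ {x} → Q x → GridPath Q x x
  step : ∀ {x y z} → Q x → GridAdj x y → GridPath Q y z → GridPath Q x z

square-cycle : ∀ {Q : Pt → Set} {a a' b b'} → OneApart a a' → OneApart b b' →
  Q (a , b) → Q (a , b') → Q (a' , b') → Q (a' , b) → CycleIn GridAdj Q
square-cycle {a = a} {a'} {b} {b'} da db q₁ q₂ q₃ q₄ =
  ((a , b) ∷ (a , b') ∷ (a' , b') ∷ (a' , b) ∷ []) , (a , b) , (a' , b) ,
  s≤s (s≤s (s≤s z≤n)) ,
  ((col ∘ cong proj₂ ∷ row ∘ cong proj₁ ∷ row ∘ cong proj₁ ∷ []) ∷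
   (row ∘ cong proj₁ ∷ row ∘ cong proj₁ ∷ []) ∷
   (col ∘ sym ∘ cong proj₂ ∷ []) ∷ [] ∷ []) ,
  (q₁ ∷ q₂ ∷ q₃ ∷ q₄ ∷ []) ,
  (inj₂ (refl , db) ∷ inj₁ (da , refl) ∷ inj₂ (refl , apart-sym db) ∷ [-]) ,
  refl , refl , inj₁ (apart-sym da , refl)
  where
  row : a ≢ a'
  row refl = apart-irrefl da
  col : b ≢ b'
  col refl = apart-irrefl db

odd : ℕ → Bool
odd zero    = false
odd (suc n) = not (odd n)

odd-apart : ∀ {a b} → OneApart a b → odd b ≡ not (odd a)
odd-apart (inj₁ refl) = refl
odd-apart {b = b} (inj₂ refl) = sym (not-involutive (odd b))

odd-double : ∀ q → odd (q * 2) ≡ false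
odd-double zero = refl
odd-double (suc q) = cong (not ∘ not) (odd-double q)

even-odd : ∀ {r} → 2 ∣ r → odd r ≡ false
even-odd (divides q refl) = odd-double q

odd-not-even : ∀ n → ¬ (2 ∣ n) → odd n ≡ true
odd-not-even n n-odd = ¬-not (n-odd ∘ even-of)
  where
  even-of : ∀ {n} → odd n ≡ false → 2 ∣ n
  even-of {zero} _ = divides 0 refl
  even-of {suc zero} ()
  even-of {suc (suc n)} e with even-of {n} (trans (sym (not-involutive (odd n))) e)
  ... | divides q refl = divides (suc q) refl

EvenPt : Pt → Set
EvenPt (i , j) = odd i ≡ false × odd j ≡ false

OddPt : Pt → Set
OddPt (i , j) = odd i ≡ true × odd j ≡ true

Mixed : Pt → Set
Mixed (i , j) = odd i ≢ odd j

-- Parity classes of neighbours: an edge step flips one coordinate's parity,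
-- a diagonal step flips both.
even-neighbour : ∀ {x y} → EvenPt x → GridAdj x y → Mixed y
even-neighbour (ei , ej) (inj₁ (d , refl)) rewrite odd-apart d | ei | ej = λ ()
even-neighbour (ei , ej) (inj₂ (refl , d)) rewrite odd-apart d | ei | ej = λ ()

same-parity : ∀ {i j} → odd i ≡ odd j → EvenPt (i , j) ⊎ OddPt (i , j)
same-parity {j = j} e with odd j
... | false = inj₁ (e , refl)
... | true  = inj₂ (e , refl)

mixed-neighbour : ∀ {x y} → Mixed x → GridAdj x y → EvenPt y ⊎ OddPt y
mixed-neighbour {i , j} {i' , _} mx (inj₁ (d , refl)) =
  same-parity {i'} {j} (trans (odd-apart d) (trans (cong not (¬-not mx)) (not-involutive (odd j))))
mixed-neighbour {i , j} {_ , j'} mx (inj₂ (refl , d)) =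
  same-parity {i} {j'} (sym (trans (odd-apart d) (trans (cong not (¬-not (≢-sym mx))) (not-involutive (odd i)))))

diagonal-mixed : ∀ {x y} → Mixed x → Diagonal x y → Mixed y
diagonal-mixed mx (di , dj) e = mx (not-injective (trans (sym (odd-apart di)) (trans e (odd-apart dj))))

bool-clash : ∀ {a b : Bool} → a ≡ false → b ≡ true → a ≢ b
bool-clash refl refl ()

path-start : ∀ {Q : Pt → Set} {x y} → GridPath Q x y → Q x
path-start (stop q)     = q
path-start (step q _ _) = q

-- The 2×2 block with top-left cell (u , v).
Near : ℕ → ℕ → Set
Near u a = a ≡ u ⊎ a ≡ suc u

InBlock : Pt → Pt → Set
InBlock (u , v) (i , j) = Near u i × Near v j

same-block : ∀ {p x y} → InBlock p x → InBlock p y → x ≡ y ⊎ GridAdj x y ⊎ Diagonal x y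
same-block (ni , nj) (ni' , nj') = near-points (near-near ni ni') (near-near nj nj')
  where
  near-near : ∀ {u a b} → Near u a → Near u b → a ≡ b ⊎ OneApart a b
  near-near (inj₁ refl) (inj₁ refl) = inj₁ refl
  near-near (inj₁ refl) (inj₂ refl) = inj₂ (inj₁ refl)
  near-near (inj₂ refl) (inj₁ refl) = inj₂ (inj₂ refl)
  near-near (inj₂ refl) (inj₂ refl) = inj₁ refl

data Dir : Set where
  up right down left : Dir

clockwise : Dir → Dir
clockwise up    = right
clockwise right = down
clockwise down  = left
clockwise left  = up

clockwise-orbit : ∀ d → clockwise d ≢ d × clockwise (clockwise d) ≢ d ×
  clockwise (clockwise (clockwise d)) ≢ d × clockwise (clockwise (clockwise (clockwise d))) ≡ d
clockwise-orbit up    = (λ ()) , (λ ()) , (λ ()) , refl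
clockwise-orbit right = (λ ()) , (λ ()) , (λ ()) , refl
clockwise-orbit down  = (λ ()) , (λ ()) , (λ ()) , refl
clockwise-orbit left  = (λ ()) , (λ ()) , (λ ()) , refl

three-steps : {A : Set} → DecidableEquality A → ∀ {a b e f : A} →
  a ≢ f → a ≢ b ⊎ b ≢ e ⊎ e ≢ f
three-steps _≟_ {a} {b} {e} a≢f with a ≟ b | b ≟ e
... | no a≢b   | _        = inj₁ a≢b
... | yes refl | no b≢e   = inj₂ (inj₁ b≢e)
... | yes refl | yes refl = inj₂ (inj₂ a≢f)

-- A colouring of the four blocks around a cell that changes across one of
-- the four sides changes across another one as well.
another-change : {A : Set} → DecidableEquality A → (c : Dir → A) →
  ∀ d → c d ≢ c (clockwise d) → ∃[ d' ] (d' ≢ d × c d' ≢ c (clockwise d'))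
another-change _≟_ c d differ with three-steps _≟_ (≢-sym differ) | clockwise-orbit d
... | inj₁ change        | moved , _ = clockwise d , moved , change
... | inj₂ (inj₁ change) | _ , moved , _ = clockwise (clockwise d) , moved , change
... | inj₂ (inj₂ change) | _ , _ , moved , back =
  clockwise (clockwise (clockwise d)) , moved ,
  subst (λ d' → c (clockwise (clockwise (clockwise d))) ≢ c d') (sym back) change

switch : {A : Set} → DecidableEquality A → (f : ℕ → A) →
  ∀ d b → f b ≢ f (d + b) → ∃[ j ] (f j ≢ f (suc j))
switch _≟_ f zero    b differ = ⊥-elim (differ refl)
switch _≟_ f (suc d) b differ with f b ≟ f (suc b)
... | no changes = b , changes
... | yes same   = switch _≟_ f d (suc b)
  (λ e → differ (trans same (trans e (cong f (+-suc d b)))))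

Rim : ℕ → ℕ → Set
Rim N x = x ≡ 1 ⊎ x ≡ N

Mid : ℕ → ℕ → Set
Mid N x = 2 ≤ x × x ≤ N ∸ 1

Within : ℕ → ℕ → Set
Within N x = 1 ≤ x × x ≤ N

InFrame : ℕ → Pt → Set
InFrame N (i , j) = Within N i × Within N j

Inner : ℕ → Pt → Set
Inner N (i , j) = Mid N i × Mid N j

OnSide : ℕ → Pt → Set
OnSide N (i , j) = (Rim N i × Mid N j) ⊎ (Mid N i × Rim N j)

mid? : ∀ N x → Dec (Mid N x)
mid? N x = (2 ℕ.≤? x) ×-dec (x ℕ.≤? N ∸ 1)

module CoordinateFacts (N : ℕ) (N≥3 : 3 ≤ N) where

  suc-N-1 : suc (N ∸ 1) ≡ N
  suc-N-1 = ℕ.suc-pred N {{>-nonZero (≤-trans (s≤s z≤n) N≥3)}}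

  2≤N-1 : 2 ≤ N ∸ 1
  2≤N-1 = <⇒≤pred N≥3

  N≰N-1 : ¬ (N ≤ N ∸ 1)
  N≰N-1 N≤ = 1+n≰n (subst (_≤ N ∸ 1) (sym suc-N-1) N≤)

  within-cases : ∀ {x} → Within N x → Rim N x ⊎ Mid N x
  within-cases {x} (1≤x , x≤N) with x ℕ.≟ 1 | x ℕ.≟ N
  ... | yes x≡1 | _       = inj₁ (inj₁ x≡1)
  ... | no _    | yes x≡N = inj₁ (inj₂ x≡N)
  ... | no x≢1  | no x≢N  = inj₂ (≤∧≢⇒< 1≤x (x≢1 ∘ sym) , <⇒≤pred (≤∧≢⇒< x≤N x≢N))

  mid-step : ∀ {x x'} → Mid N x → OneApart x x' → Within N x'
  mid-step (_ , x≤) (inj₁ refl) = s≤s z≤n , subst (_ ≤_) suc-N-1 (s≤s x≤)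
  mid-step {x' = x'} (s≤s 1≤x' , x≤) (inj₂ refl) =
    1≤x' , ≤-trans (n≤1+n x') (≤-trans x≤ ℕ.pred[n]≤n)

  rim-not-mid : ∀ {x} → Rim N x → ¬ Mid N x
  rim-not-mid (inj₁ refl) (s≤s () , _)
  rim-not-mid (inj₂ refl) (_ , N≤) = N≰N-1 N≤

  rim-inward : ∀ {x} → Rim N x → ∃[ x' ] (Mid N x' × OneApart x' x)
  rim-inward (inj₁ refl) = 2 , (≤-refl , 2≤N-1) , inj₂ refl
  rim-inward (inj₂ refl) = N ∸ 1 , (2≤N-1 , ≤-refl) , inj₁ (sym suc-N-1)

  rim-odd : odd N ≡ true → ∀ {x} → Rim N x → odd x ≡ true
  rim-odd _     (inj₁ refl) = refl
  rim-odd N-odd (inj₂ refl) = N-odd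

module FramedTree (N : ℕ) (N≥4 : 4 ≤ N) (N-odd : odd N ≡ true)
  (T : Pt → Set) (T? : ∀ x → Dec (T x))
  (in-frame : ∀ {x} → T x → InFrame N x)
  (sides : ∀ {x} → OnSide N x → T x)
  (isolated : ∀ {x y} → Inner N x → ¬ T x → GridAdj x y → ¬ T y → ⊥)
  (acyclic : ¬ CycleIn GridAdj T)
  (B : ℕ) (bounded : ∀ xs → Unique xs → All T xs → length xs ≤ B)
  (connected : ∀ {x y} → T x → T y → GridPath T x y) where

  open CoordinateFacts N (≤-trans (n≤1+n 3) N≥4)

  -- A mixed cell of the frame is inner or a tile (mixed border cells are not
  -- corners, since the corners are odd-odd).
  mixed-frame : ∀ {x} → InFrame N x → Mixed x → Inner N x ⊎ T x
  mixed-frame (wi , wj) mx with within-cases wi | within-cases wj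
  ... | inj₂ mi | inj₂ mj = inj₁ (mi , mj)
  ... | inj₁ ri | inj₂ mj = inj₂ (sides (inj₁ (ri , mj)))
  ... | inj₂ mi | inj₁ rj = inj₂ (sides (inj₂ (mi , rj)))
  ... | inj₁ ri | inj₁ rj = ⊥-elim (mx (trans (rim-odd N-odd ri) (sym (rim-odd N-odd rj))))

  OddHole : Pt → Set
  OddHole x = Inner N x × Mixed x × ¬ T x

  odd-hole? : ∀ x → Dec (OddHole x)
  odd-hole? (i , j) = (mid? N i ×-dec mid? N j) ×-dec ¬? (odd i Bool.≟ odd j) ×-dec ¬? (T? (i , j))

  diagonal-odd-hole : ∀ {h y} → OddHole h → Diagonal h y → ¬ T y → OddHole y
  diagonal-odd-hole ((mi , mj) , mx , _) (di , dj) empty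
    with mixed-frame (mid-step mi di , mid-step mj dj) (diagonal-mixed mx (di , dj))
  ... | inj₁ inner = inner , diagonal-mixed mx (di , dj) , empty
  ... | inj₂ tile  = ⊥-elim (empty tile)

  HoleIn : Pt → Set
  HoleIn (u , v) = OddHole (u , v) ⊎ OddHole (u , suc v) ⊎ OddHole (suc u , v) ⊎ OddHole (suc u , suc v)

  hole-in? : ∀ p → Dec (HoleIn p)
  hole-in? (u , v) = odd-hole? _ ⊎-dec odd-hole? _ ⊎-dec odd-hole? _ ⊎-dec odd-hole? _

  hasHole : Pt → Bool
  hasHole p = does (hole-in? p)

  hole-in-block : ∀ {p h} → InBlock p h → OddHole h → HoleIn p
  hole-in-block (inj₁ refl , inj₁ refl) o = inj₁ o
  hole-in-block (inj₁ refl , inj₂ refl) o = inj₂ (inj₁ o)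
  hole-in-block (inj₂ refl , inj₁ refl) o = inj₂ (inj₂ (inj₁ o))
  hole-in-block (inj₂ refl , inj₂ refl) o = inj₂ (inj₂ (inj₂ o))

  hole-of-block : ∀ {p} → HoleIn p → ∃[ h ] (InBlock p h × OddHole h)
  hole-of-block (inj₁ o)                = _ , (inj₁ refl , inj₁ refl) , o
  hole-of-block (inj₂ (inj₁ o))         = _ , (inj₁ refl , inj₂ refl) , o
  hole-of-block (inj₂ (inj₂ (inj₁ o)))  = _ , (inj₂ refl , inj₁ refl) , o
  hole-of-block (inj₂ (inj₂ (inj₂ o)))  = _ , (inj₂ refl , inj₂ refl) , o

  hasHole-differs : ∀ {p q} → HoleIn p → ¬ HoleIn q → hasHole p ≢ hasHole q
  hasHole-differs {p} {q} hp nq e =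
    bool-clash (dec-false (hole-in? q) nq) (dec-true (hole-in? p) hp) (sym e)

  no-hole-beyond : ∀ u v → N ≤ v → ¬ HoleIn (u , v)
  no-hole-beyond u v N≤v holed with hole-of-block holed
  ... | _ , (_ , inj₁ refl) , ((_ , (_ , j≤)) , _) = N≰N-1 (≤-trans N≤v j≤)
  ... | _ , (_ , inj₂ refl) , ((_ , (_ , j≤)) , _) = N≰N-1 (≤-trans N≤v (≤-trans (n≤1+n v) j≤))

  -- An empty cell lies in a block with an odd hole only if all four of its
  -- blocks have one: the hole is the cell itself or a diagonal neighbour,
  -- since holes have no empty edge-neighbour.
  hole-spreads : ∀ {p q y} → InBlock p y → InBlock q y → ¬ T y → HoleIn p → HoleIn q
  hole-spreads y∈p y∈q empty holed with hole-of-block holed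
  ... | h , h∈p , oh with same-block h∈p y∈p
  ... | inj₁ refl        = hole-in-block y∈q oh
  ... | inj₂ (inj₁ adj)  = ⊥-elim (isolated (proj₁ oh) (proj₂ (proj₂ oh)) adj empty)
  ... | inj₂ (inj₂ diag) = hole-in-block y∈q (diagonal-odd-hole oh diag empty)

  separating-tile : ∀ {p q y} → InBlock p y → InBlock q y → hasHole p ≢ hasHole q → T y
  separating-tile {p} {q} y∈p y∈q differ = decidable-stable (T? _) λ empty →
    differ (does-⇔ (mk⇔ (hole-spreads y∈p y∈q empty) (hole-spreads y∈q y∈p empty))
                   (hole-in? p) (hole-in? q))

  -- Walls: the domino (i , j)—(i , j+1) is shared by the blocks (i-1 , j) and
  -- (i , j); the domino (i , j)—(i+1 , j) by the blocks (i , j-1) and (i , j).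
  -- It is a wall when exactly one of its two blocks has an odd hole.
  HWall : Pt → Set
  HWall (zero  , j) = ⊥
  HWall (suc a , j) = hasHole (a , j) ≢ hasHole (suc a , j)

  VWall : Pt → Set
  VWall (i , zero)  = ⊥
  VWall (i , suc b) = hasHole (i , b) ≢ hasHole (i , suc b)

  data Wall : Pt → Pt → Set where
    wallE : ∀ {i j} → HWall (i , j) → Wall (i , j) (i , suc j)
    wallW : ∀ {i j} → HWall (i , j) → Wall (i , suc j) (i , j)
    wallS : ∀ {i j} → VWall (i , j) → Wall (i , j) (suc i , j)
    wallN : ∀ {i j} → VWall (i , j) → Wall (suc i , j) (i , j)

  wall-sym : ∀ {x y} → Wall x y → Wall y x
  wall-sym (wallE w) = wallW w
  wall-sym (wallW w) = wallE w
  wall-sym (wallS w) = wallN w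
  wall-sym (wallN w) = wallS w

  wall-adjacent : ∀ {x y} → Wall x y → GridAdj x y
  wall-adjacent (wallE _) = inj₂ (refl , inj₁ refl)
  wall-adjacent (wallW _) = inj₂ (refl , inj₂ refl)
  wall-adjacent (wallS _) = inj₁ (inj₁ refl , refl)
  wall-adjacent (wallN _) = inj₁ (inj₂ refl , refl)

  hwall-tiles : ∀ {i j} → HWall (i , j) → T (i , j) × T (i , suc j)
  hwall-tiles {suc a} w =
    separating-tile (inj₂ refl , inj₁ refl) (inj₁ refl , inj₁ refl) w ,
    separating-tile (inj₂ refl , inj₂ refl) (inj₁ refl , inj₂ refl) w

  vwall-tiles : ∀ {i j} → VWall (i , j) → T (i , j) × T (suc i , j)
  vwall-tiles {j = suc b} w =
    separating-tile (inj₁ refl , inj₂ refl) (inj₁ refl , inj₁ refl) w ,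
    separating-tile (inj₂ refl , inj₂ refl) (inj₂ refl , inj₁ refl) w

  wall-source : ∀ {x y} → Wall x y → T x
  wall-source (wallE w) = proj₁ (hwall-tiles w)
  wall-source (wallW w) = proj₂ (hwall-tiles w)
  wall-source (wallS w) = proj₁ (vwall-tiles w)
  wall-source (wallN w) = proj₂ (vwall-tiles w)

  -- The four blocks containing the cell (a+1 , b+1): block d is the one
  -- between the walls leaving the cell in directions d and clockwise⁻¹ d, so
  -- the wall towards neighbour d separates block d and block (clockwise d).
  module AroundCell (a b : ℕ) where

    block : Dir → Pt
    block up    = a , b
    block right = a , suc b
    block down  = suc a , suc b
    block left  = suc a , b

    neighbour : Dir → Pt
    neighbour up    = a , suc b
    neighbour right = suc a , suc (suc b)
    neighbour down  = suc (suc a) , suc b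
    neighbour left  = suc a , b

    WallTowards : Dir → Set
    WallTowards d = hasHole (block d) ≢ hasHole (block (clockwise d))

    to-wall : ∀ d → WallTowards d → Wall (suc a , suc b) (neighbour d)
    to-wall up    w = wallN w
    to-wall right w = wallE w
    to-wall down  w = wallS (≢-sym w)
    to-wall left  w = wallW (≢-sym w)

    from-wall : ∀ {x} → Wall x (suc a , suc b) → ∃[ d ] (x ≡ neighbour d × WallTowards d)
    from-wall (wallE w) = left  , refl , ≢-sym w
    from-wall (wallW w) = right , refl , w
    from-wall (wallS w) = up    , refl , w
    from-wall (wallN w) = down  , refl , ≢-sym w

    neighbour-injective : ∀ {d d'} → neighbour d ≡ neighbour d' → d ≡ d'
    neighbour-injective {up}    {up}    _  = refl
    neighbour-injective {up}    {right} ()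
    neighbour-injective {up}    {down}  ()
    neighbour-injective {up}    {left}  ()
    neighbour-injective {right} {up}    ()
    neighbour-injective {right} {right} _  = refl
    neighbour-injective {right} {down}  ()
    neighbour-injective {right} {left}  ()
    neighbour-injective {down}  {up}    ()
    neighbour-injective {down}  {right} ()
    neighbour-injective {down}  {down}  _  = refl
    neighbour-injective {down}  {left}  ()
    neighbour-injective {left}  {up}    ()
    neighbour-injective {left}  {right} ()
    neighbour-injective {left}  {down}  ()
    neighbour-injective {left}  {left}  _  = refl

    continue-at : ∀ {x} → Wall x (suc a , suc b) → ∃[ z ] (Wall (suc a , suc b) z × z ≢ x)
    continue-at w with from-wall w
    ... | d , refl , wd with another-change Bool._≟_ (hasHole ∘ block) d wd
    ... | d' , d'≢d , wd' = neighbour d' , to-wall d' wd' , d'≢d ∘ neighbour-injective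

  -- Walls have no dead ends (wall cells are tiles, so have positive coordinates).
  wall-continues : ∀ {x y} → Wall x y → ∃[ z ] (Wall y z × z ≢ x)
  wall-continues w with in-frame (wall-source (wall-sym w))
  ... | (s≤s {n = a} _ , _) , (s≤s {n = b} _ , _) = AroundCell.continue-at a b w

  -- A wall exists if there is an odd hole: going right from its block, the
  -- blocks eventually contain no odd hole.
  first-wall : ∀ {h} → OddHole h → ∃[ x ] ∃[ y ] Wall x y
  first-wall {a , b} oh
    with switch Bool._≟_ (λ v → hasHole (a , v)) N b
           (hasHole-differs (hole-in-block (inj₁ refl , inj₁ refl) oh)
                            (no-hole-beyond a (N + b) (ℕ.m≤m+n N b)))
  ... | j , change = (a , suc j) , (suc a , suc j) , wallS change

  -- Step (1): walking along walls closes a cycle of tiles, so there is no odd hole.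
  no-odd-hole : ∀ {h} → ¬ OddHole h
  no-odd-hole oh with first-wall oh
  ... | _ , _ , w = acyclic (mapCycle (λ x → x) (λ e → e) wall-adjacent (λ t → t) (cycleThrough w))
    where
    open WalkWithoutDeadEnds (≡-dec ℕ._≟_ ℕ._≟_) (grid-adj-irrefl ∘ wall-adjacent)
           wall-sym wall-source wall-continues B bounded

  mixed-tile : ∀ {x} → InFrame N x → Mixed x → T x
  mixed-tile fr mx with mixed-frame fr mx
  ... | inj₂ tile  = tile
  ... | inj₁ inner = decidable-stable (T? _) λ empty → no-odd-hole (inner , mx , empty)

  -- A tile y adjacent to both an even-even tile f and an odd-odd tile y' is
  -- impossible: by parity f and y' are not in line with y, so with the mixed
  -- cell opposite to y, which is a tile, they close a square.
  no-odd-corner : ∀ {y f y'} → T y → EvenPt f → T f → GridAdj y f → GridAdj y y' → T y' → ¬ OddPt y'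
  no-odd-corner _ (_ , ej) _ (inj₁ (_ , refl)) (inj₁ (_ , refl)) _ (_ , oj) = bool-clash ej oj refl
  no-odd-corner _ (ei , _) _ (inj₂ (refl , _)) (inj₂ (refl , _)) _ (oi , _) = bool-clash ei oi refl
  no-odd-corner {_ , _} {fi , _} {_ , j'} ty (ei , _) tf (inj₁ (di , refl)) (inj₂ (refl , dj)) ty' (_ , oj) =
    acyclic (square-cycle di dj ty ty' corner tf)
    where
    corner : T (fi , j')
    corner = mixed-tile (proj₁ (in-frame tf) , proj₂ (in-frame ty')) (bool-clash ei oj)
  no-odd-corner {_ , _} {_ , fj} {i' , _} ty (_ , ej) tf (inj₂ (refl , dj)) (inj₁ (di , refl)) ty' (oi , _) =
    acyclic (square-cycle di dj ty tf corner ty')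
    where
    corner : T (i' , fj)
    corner = mixed-tile (proj₁ (in-frame ty') , proj₂ (in-frame tf)) (≢-sym (bool-clash ej oi))

  -- Step (2): the invariant carried along tile paths from an even-even tile.
  Guarded : Pt → Set
  Guarded y = EvenPt y ⊎ (Mixed y × ∃[ f ] (EvenPt f × T f × GridAdj y f))

  guarded-step : ∀ {y y'} → T y → Guarded y → GridAdj y y' → T y' → Guarded y'
  guarded-step ty (inj₁ ev) adj _ = inj₂ (even-neighbour ev adj , _ , ev , ty , grid-adj-sym adj)
  guarded-step ty (inj₂ (mx , f , ef , tf , yf)) adj ty' with mixed-neighbour mx adj
  ... | inj₁ ev'  = inj₁ ev'
  ... | inj₂ odd' = ⊥-elim (no-odd-corner ty ef tf yf adj ty' odd')

  guarded-path : ∀ {x w} → GridPath T x w → Guarded x → Guarded w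
  guarded-path (stop _)           g = g
  guarded-path (step tx adj rest) g = guarded-path rest (guarded-step tx g adj (path-start rest))

  top-tile : T (1 , 3)
  top-tile = sides (inj₁ (inj₁ refl , (s≤s (s≤s z≤n) , <⇒≤pred N≥4)))

  -- No even-even cell is a tile: it would be joined by a path to (1 , 3).
  no-even-tile : ∀ {x} → EvenPt x → ¬ T x
  no-even-tile ev tx with guarded-path (connected tx top-tile) (inj₁ ev)
  ... | inj₁ (() , _)
  ... | inj₂ (mx , _) = mx refl

open import Data.List.Membership.DecPropositional (≡-dec ℤ._≟_ ℤ._≟_) using (_∈?_)

interior-not-beside-outside : ∀ A {w o} → Interior A w → Adj w o → ¬ Outside A o
interior-not-beside-outside A {w} (not-outside , not-boundary) w~o out with w ∈? A
... | yes w∈A = not-boundary (w∈A , _ , w~o , out)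
... | no  w∉A = not-outside (w∉A , λ B →
  let (y , path , far) = proj₂ out B in y , step w∉A w~o path , far)

tile-beside-interior : ∀ A {w o} → Interior A w → Adj w o → ¬ Interior A o → o ∈ A
tile-beside-interior A int w~o not-int = decidable-stable (_ ∈? A) λ o∉A →
  not-int (interior-not-beside-outside A int w~o , λ boundary → o∉A (proj₁ boundary))

emb : Pt → Cell
emb (i , j) = + i , + j

emb-injective : ∀ {x y} → emb x ≡ emb y → x ≡ y
emb-injective {_ , _} refl = refl

apart-ℤ : ∀ {a b} → OneApart a b → (+ b ≡ + a ℤ.+ ℤ.1ℤ ⊎ + a ≡ + b ℤ.+ ℤ.1ℤ)
apart-ℤ {a}     (inj₁ refl) = inj₁ (cong +_ (+-comm 1 a))
apart-ℤ {b = b} (inj₂ refl) = inj₂ (cong +_ (+-comm 1 b))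

ℤ-apart : ∀ {a b} → (+ b ≡ + a ℤ.+ ℤ.1ℤ ⊎ + a ≡ + b ℤ.+ ℤ.1ℤ) → OneApart a b
ℤ-apart {a}     (inj₁ e) = inj₁ (trans (+-injective e) (+-comm a 1))
ℤ-apart {b = b} (inj₂ e) = inj₂ (trans (+-injective e) (+-comm b 1))

adj-emb : ∀ {x y} → GridAdj x y → Adj (emb x) (emb y)
adj-emb (inj₁ (d , refl)) = inj₁ (apart-ℤ d , refl)
adj-emb (inj₂ (refl , d)) = inj₂ (refl , apart-ℤ d)

emb-adj : ∀ {x y} → Adj (emb x) (emb y) → GridAdj x y
emb-adj (inj₁ (d , e)) = inj₁ (ℤ-apart d , +-injective e)
emb-adj (inj₂ (e , d)) = inj₂ (+-injective e , ℤ-apart d)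

module GridImage (N : ℕ) (N≥3 : 3 ≤ N) (A : Tiles)
  (in-square : ∀ x → x ∈ A → InSquare 1 N x)
  (interior : ∀ x → Interior A x ⇔ InSquare 2 (N ∸ 1) x) where

  open CoordinateFacts N N≥3

  Tiled : Pt → Set
  Tiled x = emb x ∈ A

  tiled? : ∀ x → Dec (Tiled x)
  tiled? x = emb x ∈? A

  inner-interior : ∀ {x} → Inner N x → Interior A (emb x)
  inner-interior ((i₁ , i₂) , (j₁ , j₂)) =
    Equivalence.from (interior _) ((ℤ.+≤+ i₁ , ℤ.+≤+ i₂) , (ℤ.+≤+ j₁ , ℤ.+≤+ j₂))

  interior-inner : ∀ {x} → Interior A (emb x) → Inner N x
  interior-inner int with Equivalence.to (interior _) int
  ... | (i₁ , i₂) , (j₁ , j₂) = (drop‿+≤+ i₁ , drop‿+≤+ i₂) , (drop‿+≤+ j₁ , drop‿+≤+ j₂)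

  in-frame : ∀ {x} → Tiled x → InFrame N x
  in-frame t with in-square _ t
  ... | (i₁ , i₂) , (j₁ , j₂) = (drop‿+≤+ i₁ , drop‿+≤+ i₂) , (drop‿+≤+ j₁ , drop‿+≤+ j₂)

  -- Border cells are next to an interior cell without being interior.
  sides : ∀ {x} → OnSide N x → Tiled x
  sides (inj₁ (rim , mid)) with rim-inward rim
  ... | _ , mid' , apart = tile-beside-interior A (inner-interior (mid' , mid))
    (adj-emb (inj₁ (apart , refl))) (rim-not-mid rim ∘ proj₁ ∘ interior-inner)
  sides (inj₂ (mid , rim)) with rim-inward rim
  ... | _ , mid' , apart = tile-beside-interior A (inner-interior (mid , mid'))
    (adj-emb (inj₂ (refl , apart))) (rim-not-mid rim ∘ proj₂ ∘ interior-inner)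

  -- An empty inner cell is a hole; holes have area one, so it has no empty
  -- neighbour.
  isolated : HolesAreaOne A → ∀ {x y} → Inner N x → ¬ Tiled x → GridAdj x y → ¬ Tiled y → ⊥
  isolated area-one {x} {y} inner x∉A adj y∉A =
    grid-adj-irrefl (subst (GridAdj x) (sym (emb-injective same)) adj)
    where
    same : emb x ≡ emb y
    same = area-one _ _ (x∉A , proj₁ (inner-interior inner)) (step x∉A (adj-emb adj) (stop y∉A))

  acyclic : ¬ Cycle A → ¬ CycleIn GridAdj Tiled
  acyclic no-cycle = no-cycle ∘ mapCycle emb emb-injective adj-emb (λ t → t)

  bounded : ∀ xs → Unique xs → All Tiled xs → length xs ≤ length A
  bounded xs distinct tiled = subst (_≤ length A) (length-map emb xs)
    (unique-⊆-length (map emb xs) A (Unique.map⁺ emb-injective distinct)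
      (All.lookup (All.map⁺ {P = _∈ A} tiled)))

  -- Tiles have positive coordinates, so tile paths come from grid paths.
  tile-point : ∀ {v} → v ∈ A → ∃[ p ] (v ≡ emb p)
  tile-point {+ i , + j} _ = (i , j) , refl
  tile-point {ℤ.-[1+ _ ] , _} v∈A with in-square _ v∈A
  ... | (() , _) , _
  tile-point {+ _ , ℤ.-[1+ _ ]} v∈A with in-square _ v∈A
  ... | _ , (() , _)

  path-head : ∀ {v w} → Path (Tile A) v w → v ∈ A
  path-head (stop v∈A)     = v∈A
  path-head (step v∈A _ _) = v∈A

  lift-path : ∀ {u w} → Path (Tile A) u w → ∀ {x y} → u ≡ emb x → w ≡ emb y → GridPath Tiled x y
  lift-path (stop u∈A) {x} refl w≡ = subst (GridPath Tiled x) (emb-injective w≡) (stop u∈A)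
  lift-path (step u∈A adj rest) refl w≡ with tile-point (path-head rest)
  ... | _ , refl = step u∈A (emb-adj adj) (lift-path rest refl w≡)

  connected : (∀ x y → x ∈ A → y ∈ A → Path (Tile A) x y) →
    ∀ {x y} → Tiled x → Tiled y → GridPath Tiled x y
  connected path tx ty = lift-path (path _ _ tx ty) refl refl

-- An even-even cell of the interior is no tile by FramedTree, and, being
-- interior, it is not in the unbounded component: it lies in a hole.
mainTheorem17 : (N : ℕ) → 5 ≤ N → ¬ (2 ∣ N) → (A : Tiles) →
    IsPolyomino A → EfficientlyStructured A →
    (∀ x → x ∈ A → InSquare 1 N x) →
    (∀ x → Interior A x ⇔ InSquare 2 (N ∸ 1) x) →
    ∀ (r c : ℕ) → 2 ∣ r → 2 ∣ c → InSquare 2 (N ∸ 1) (+ r , + c) →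
    HoleCell A (+ r , + c)
mainTheorem17 N N≥5 N-odd A (_ , path) ((_ , no-cycle) , area-one , _) in-square interior
  r c 2∣r 2∣c square = not-tile , proj₁ (Equivalence.from (interior _) square)
  where
  open GridImage N (≤-trans (ℕ.m≤m+n 3 2) N≥5) A in-square interior
  not-tile : Tiled (r , c) → ⊥
  not-tile = FramedTree.no-even-tile N (≤-trans (n≤1+n 4) N≥5) (odd-not-even N N-odd)
    Tiled tiled? in-frame sides (isolated area-one) (acyclic no-cycle)
    (length A) bounded (connected path) (even-odd 2∣r , even-odd 2∣c)
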